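{- Let $\Gamma$ be a graph of size $e$ (i.e. with $e$ edges), let $d$ be a positive divisor of $e$, and suppose $f$ is a $d$-graceful labeling of $\Gamma$. Then the map $\phi: V(\Gamma)\to \mathbb{Z}_{2d(\frac{e}{d}+1)}$, $\phi(x)=f(x)$ (reduced modulo $2d(\frac{e}{d}+1)$), constitutes a $\left(2d(\frac{e}{d}+1),2d,\Gamma,1\right)$-difference family. In particular, a $d$-graceful labeling of $\Gamma$ determines a $\left(2d(\frac{e}{d}+1),2d,\Gamma,1\right)$-difference family.
   Context: For a graph $\Gamma$ of size $e$ and a divisor $d$ of $e$ with $e=d\cdot m$, a $d$-graceful labeling of $\Gamma$ is an injective function $f:V(\Gamma)\to\{0,1,\ldots,d(m+1)-1\}$ such that $\{|f(x)-f(y)| : [x,y]\in E(\Gamma)\}=\{1,2,\ldots,d(m+1)-1\}\setminus\{m+1,2(m+1),\ldots,(d-1)(m+1)\}$. For a graph $\Gamma$, $D(\Gamma)$ denotes the set of ordered pairs $(x,y)$ with $x,y$ adjacent vertices. For a divisor $d$ of $v$, a $(v,d,\Gamma,1)$-difference family is a collection $\mathcal F$ of injective maps $V(\Gamma)\to\mathbb{Z}_v$ such that the list $\{f(x)-f(y) : f\in\mathcal F,\ (x,y)\in D(\Gamma)\}$ covers every element of $\mathbb{Z}_v\setminus \frac{v}{d}\mathbb{Z}_v$ exactly once and contains no element of $\frac{v}{d}\mathbb{Z}_v$, the subgroup of $\mathbb{Z}_v$ of order $d$. -}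

module Defs where

open import Data.Nat using (ℕ; zero; suc; _+_; _*_; _∸_; _≤_; _<_; _≤?_)
open import Data.Nat.Divisibility using (_∣_)
open import Data.Fin using (Fin; toℕ)
import Data.Fin.Properties as FinP
open import Data.Product using (_×_; _,_; Σ; proj₁; proj₂)
open import Data.List using (List; []; _∷_; length; map; filter; concatMap; _++_)
open import Data.List.Relation.Unary.Unique.Propositional using (Unique)
open import Data.List.Relation.Unary.All using (All)
open import Data.List.Membership.Propositional using (_∈_)
open import Relation.Binary.PropositionalEquality using (_≡_; _≢_)
open import Relation.Nullary using (¬_; yes; no)
open import Function.Definitions using (Injective)
open import Function.Bundles using (_⇔_)

-- Each edge [x,y] is listed once (as an ordered pair, orientation irrelevant):
-- no loops, and no unordered pair occurs twice.
record Graph : Set where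
  field
    n         : ℕ
    edges     : List (Fin n × Fin n)
    noLoops   : All (λ (xy : Fin n × Fin n) → proj₁ xy ≢ proj₂ xy) edges
    noRepeats : Unique (edges ++ map (λ (xy : Fin n × Fin n) → (proj₂ xy , proj₁ xy)) edges)

open Graph public

V : Graph → Set
V Γ = Fin (n Γ)

size : Graph → ℕ
size Γ = length (edges Γ)

D : (Γ : Graph) → List (V Γ × V Γ)
D Γ = concatMap (λ (xy : V Γ × V Γ) → xy ∷ (proj₂ xy , proj₁ xy) ∷ []) (edges Γ)

absDiff : ℕ → ℕ → ℕ
absDiff a b = (a ∸ b) + (b ∸ a)

-- d-graceful labeling of Γ, where size Γ = d * m.
-- The target set {1,…,d(m+1)-1} \ {m+1,…,(d-1)(m+1)} is described as
-- { k | 1 ≤ k < d(m+1) and (m+1) ∤ k }.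
record IsGraceful (d m : ℕ) (Γ : Graph) (f : V Γ → ℕ) : Set where
  field
    injective : Injective _≡_ _≡_ f
    bounded   : ∀ x → f x < d * suc m
    edgeSet   : ∀ k → (Σ (V Γ × V Γ) λ xy → (xy ∈ edges Γ) × (absDiff (f (proj₁ xy)) (f (proj₂ xy)) ≡ k))
                      ⇔ ((1 ≤ k) × (k < d * suc m) × ¬ (suc m ∣ k))

subMod : (v : ℕ) → Fin v → Fin v → ℕ
subMod v a b with toℕ b ≤? toℕ a
... | yes _ = toℕ a ∸ toℕ b
... | no  _ = (toℕ a + v) ∸ toℕ b

-- the list ΔF = { f(x) - f(y) : f ∈ F, (x,y) ∈ D(Γ) } (as representatives in [0,v))
diffList : (v : ℕ) (Γ : Graph) → List (V Γ → Fin v) → List ℕ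
diffList v Γ F = concatMap (λ φ → map (λ (xy : V Γ × V Γ) → subMod v (φ (proj₁ xy)) (φ (proj₂ xy))) (D Γ)) F

occ : ℕ → List ℕ → ℕ
occ g xs = length (filter (λ y → y Data.Nat.≟ g) xs)

-- (v, d, Γ, 1)-difference family; d∣v : d ∣ v, and (v/d)ℤ_v is the set of
-- residues g < v divisible by the quotient v/d.
record IsDifferenceFamily (v d : ℕ) (d∣v : d ∣ v) (Γ : Graph) (F : List (V Γ → Fin v)) : Set where
  field
    injectiveMaps : All (λ φ → Injective _≡_ _≡_ φ) F
    outside       : ∀ g → g < v → ¬ (_∣_.quotient d∣v ∣ g) → occ g (diffList v Γ F) ≡ 1
    inside        : ∀ g → g < v → _∣_.quotient d∣v ∣ g → occ g (diffList v Γ F) ≡ 0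

module Submission where

-- Write p = m+1 and N = d·p, so v = 2N and (v/2d)ℤ_v = pℤ_v.  The proof is a
-- counting (pigeonhole) argument.
--   * An edge {x,y} with label distance k = |f(x) - f(y)| > 0 contributes the
--     two differences k and v - k to the difference list ΔF.  Every k ∈ [1,N)
--     with p ∤ k is such a distance, and g ↦ v - g maps the non-multiples of
--     p in [N,v) into [1,N); so every non-multiple of p in [0,v) occurs in ΔF.
--   * ΔF has 2e = 2dm entries, all in [0,v), and [0,v) contains exactly
--     2d·m non-multiples of p.
--   * A list of length n with entries in [0,v) that contains all n elements
--     of a set S ⊆ [0,v) hits each element of S exactly once and nothing else.
-- The file develops finite sums and occurrence counts, proves this pigeonhole
-- lemma and the count of non-multiples, describes the difference list of a
-- single map into ℤ_v, and finally assembles the theorem.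

open import Defs
open import Data.Nat using (ℕ; zero; suc; _+_; _*_; _∸_; _≤_; _<_; _≟_; _≤?_; _<?_; z≤n; s≤s)
open import Data.Nat.Properties
open import Data.Nat.Divisibility using (_∣_; _∣?_; divides; _∣0; ∣-refl; ∣⇒≤; ∣m+n∣m⇒∣n; ∣m∣n⇒∣m+n)
open import Data.Fin using (Fin; toℕ)
open import Data.Fin.Properties using (toℕ<n)
open import Data.List using (List; []; _∷_; map; concatMap; length)
open import Data.List.Properties using (++-identityʳ; length-map; filter-accept; filter-reject)
open import Data.List.Relation.Unary.All using (All; []; _∷_; universal)
import Data.List.Relation.Unary.All.Properties as All
open import Data.List.Relation.Unary.Any using (here; there)
open import Data.List.Membership.Propositional using (_∈_)
open import Data.List.Membership.Propositional.Properties using (∈-map⁺)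
open import Data.Product using (_×_; _,_; proj₁; proj₂)
open import Data.Sum using (inj₁; inj₂)
open import Function.Bundles using (Equivalence)
open import Function.Definitions using (Injective)
open import Relation.Nullary using (¬_; Dec; yes; no; ¬?; contradiction)
open import Relation.Unary using (Decidable)
open import Relation.Binary.Definitions using (tri<; tri≈; tri>)
open import Relation.Binary.PropositionalEquality
  using (_≡_; _≢_; ≢-sym; refl; sym; trans; cong; cong₂; subst; module ≡-Reasoning)
open import Algebra.Properties.CommutativeSemigroup +-commutativeSemigroup using (interchange)

below-suc : ∀ {N} {P : ℕ → Set} → (∀ k → k < suc N → P k) → ∀ k → k < N → P k
below-suc h k k<N = h k (m<n⇒m<1+n k<N)

sumBelow : ℕ → (ℕ → ℕ) → ℕ
sumBelow zero    h = 0
sumBelow (suc N) h = sumBelow N h + h N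

sumBelow-cong : ∀ N {a b : ℕ → ℕ} → (∀ k → k < N → a k ≡ b k) → sumBelow N a ≡ sumBelow N b
sumBelow-cong zero    a≡b = refl
sumBelow-cong (suc N) a≡b =
  cong₂ _+_ (sumBelow-cong N (below-suc a≡b)) (a≡b N ≤-refl)

sumBelow-+ : ∀ N (a b : ℕ → ℕ) → sumBelow N (λ k → a k + b k) ≡ sumBelow N a + sumBelow N b
sumBelow-+ zero    a b = refl
sumBelow-+ (suc N) a b =
  trans (cong (_+ (a N + b N)) (sumBelow-+ N a b)) (interchange (sumBelow N a) (sumBelow N b) (a N) (b N))

sumBelow-zero : ∀ N → sumBelow N (λ _ → 0) ≡ 0
sumBelow-zero zero    = refl
sumBelow-zero (suc N) = trans (+-identityʳ _) (sumBelow-zero N)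

sumBelow-split : ∀ M N (h : ℕ → ℕ) → sumBelow (M + N) h ≡ sumBelow M h + sumBelow N (λ j → h (M + j))
sumBelow-split M zero    h = trans (cong (λ L → sumBelow L h) (+-identityʳ M)) (sym (+-identityʳ _))
sumBelow-split M (suc N) h rewrite +-suc M N =
  trans (cong (_+ h (M + N)) (sumBelow-split M N h)) (+-assoc (sumBelow M h) _ _)

sumBelow-mono : ∀ N {a b : ℕ → ℕ} → (∀ k → k < N → a k ≤ b k) → sumBelow N a ≤ sumBelow N b
sumBelow-mono zero    a≤b = z≤n
sumBelow-mono (suc N) a≤b = +-mono-≤ (sumBelow-mono N (below-suc a≤b)) (a≤b N ≤-refl)

+-squeeze : ∀ {A B a b} → A ≤ B → a ≤ b → A + a ≡ B + b → A ≡ B × a ≡ b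
+-squeeze {A} {B} {a} {b} A≤B a≤b eq = A≡B , +-cancelˡ-≡ A a b (trans eq (cong (_+ b) (sym A≡B)))
  where
  A≡B : A ≡ B
  A≡B = ≤-antisym A≤B (+-cancelʳ-≤ b B A (subst (_≤ A + b) eq (+-monoʳ-≤ A a≤b)))

sumBelow-squeeze : ∀ N {a b : ℕ → ℕ} → (∀ k → k < N → a k ≤ b k) →
                   sumBelow N a ≡ sumBelow N b → ∀ k → k < N → a k ≡ b k
sumBelow-squeeze (suc N) {a} {b} a≤b eq k k<1+N
  with +-squeeze (sumBelow-mono N (below-suc a≤b)) (a≤b N ≤-refl) eq | m<1+n⇒m<n∨m≡n k<1+N
... | sums≡ , _     | inj₁ k<N  = sumBelow-squeeze N (below-suc a≤b) sums≡ k k<N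
... | _     , last≡ | inj₂ refl = last≡

𝟙 : {A : Set} → Dec A → ℕ
𝟙 (yes _) = 1
𝟙 (no  _) = 0

𝟙-yes : {A : Set} → A → (A? : Dec A) → 𝟙 A? ≡ 1
𝟙-yes a (yes _) = refl
𝟙-yes a (no ¬a) = contradiction a ¬a

𝟙-no : {A : Set} → ¬ A → (A? : Dec A) → 𝟙 A? ≡ 0
𝟙-no ¬a (yes a) = contradiction a ¬a
𝟙-no ¬a (no  _) = refl

𝟙-cong : {A B : Set} → (A → B) → (B → A) → (A? : Dec A) (B? : Dec B) → 𝟙 A? ≡ 𝟙 B?
𝟙-cong A→B B→A (yes a) B? = sym (𝟙-yes (A→B a) B?)
𝟙-cong A→B B→A (no ¬a) B? = sym (𝟙-no (λ b → ¬a (B→A b)) B?)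

sumBelow-point : ∀ N x → x < N → sumBelow N (λ k → 𝟙 (x ≟ k)) ≡ 1
sumBelow-point (suc N) x x<1+N with m<1+n⇒m<n∨m≡n x<1+N
... | inj₁ x<N  = cong₂ _+_ (sumBelow-point N x x<N) (𝟙-no (<⇒≢ x<N) (x ≟ N))
... | inj₂ refl = cong₂ _+_ below (𝟙-yes refl (x ≟ x))
  where
  below : sumBelow x (λ k → 𝟙 (x ≟ k)) ≡ 0
  below = trans (sumBelow-cong x (λ k k<x → 𝟙-no (≢-sym (<⇒≢ k<x)) (x ≟ k))) (sumBelow-zero x)

occ-∷ : ∀ g x xs → occ g (x ∷ xs) ≡ 𝟙 (x ≟ g) + occ g xs
occ-∷ g x xs with x ≟ g
... | yes x≡g = cong length (filter-accept (_≟ g) x≡g)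
... | no  x≢g = cong length (filter-reject (_≟ g) x≢g)

occ-∈ : ∀ {g} xs → g ∈ xs → 1 ≤ occ g xs
occ-∈ {g} (x ∷ xs) (here refl)  rewrite occ-∷ g g xs | 𝟙-yes refl (g ≟ g) = s≤s z≤n
occ-∈ {g} (x ∷ xs) (there g∈xs) rewrite occ-∷ g x xs = ≤-trans (occ-∈ xs g∈xs) (m≤n+m _ _)

sumBelow-occ : ∀ N xs → All (_< N) xs → sumBelow N (λ k → occ k xs) ≡ length xs
sumBelow-occ N []       []           = sumBelow-zero N
sumBelow-occ N (x ∷ xs) (x<N ∷ xs<N) = begin
  sumBelow N (λ k → occ k (x ∷ xs))                          ≡⟨ sumBelow-cong N (λ k _ → occ-∷ k x xs) ⟩
  sumBelow N (λ k → 𝟙 (x ≟ k) + occ k xs)                   ≡⟨ sumBelow-+ N _ _ ⟩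
  sumBelow N (λ k → 𝟙 (x ≟ k)) + sumBelow N (λ k → occ k xs) ≡⟨ cong₂ _+_ (sumBelow-point N x x<N) (sumBelow-occ N xs xs<N) ⟩
  1 + length xs                                              ∎
  where open ≡-Reasoning

occ-exact : {P : ℕ → Set} (P? : Decidable P) (N : ℕ) (xs : List ℕ) →
            All (_< N) xs → (∀ k → k < N → P k → k ∈ xs) →
            length xs ≡ sumBelow N (λ k → 𝟙 (P? k)) →
            ∀ k → k < N → occ k xs ≡ 𝟙 (P? k)
occ-exact P? N xs xs<N covers len k k<N =
  sym (sumBelow-squeeze N indicator≤occ (sym (trans (sumBelow-occ N xs xs<N) len)) k k<N)
  where
  indicator≤occ : ∀ k → k < N → 𝟙 (P? k) ≤ occ k xs
  indicator≤occ k k<N with P? k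
  ... | yes Pk = occ-∈ xs (covers k k<N Pk)
  ... | no  _  = z≤n

nonMultiple? : ∀ p → Decidable (λ g → ¬ (p ∣ g))
nonMultiple? p g = ¬? (p ∣? g)

nonMultiples : ∀ m D → sumBelow (D * suc m) (λ k → 𝟙 (nonMultiple? (suc m) k)) ≡ D * m
nonMultiples m zero    = refl
nonMultiples m (suc D) = begin
  sumBelow (suc m + D * suc m) ind                          ≡⟨ sumBelow-split (suc m) (D * suc m) ind ⟩
  sumBelow (suc m) ind + sumBelow (D * suc m) (λ j → ind (suc m + j))
                                                            ≡⟨ cong₂ _+_ firstBlock (sumBelow-cong (D * suc m) (λ j _ → periodic j)) ⟩
  m + sumBelow (D * suc m) ind                              ≡⟨ cong (m +_) (nonMultiples m D) ⟩
  m + D * m                                                 ∎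
  where
  open ≡-Reasoning
  ind : ℕ → ℕ
  ind k = 𝟙 (nonMultiple? (suc m) k)

  periodic : ∀ j → ind (suc m + j) ≡ ind j
  periodic j = 𝟙-cong (λ ∤m+j m∣j → ∤m+j (∣m∣n⇒∣m+n ∣-refl m∣j))
                      (λ ∤j m∣m+j → ∤j (∣m+n∣m⇒∣n m∣m+j ∣-refl)) _ _

  firstBlock : sumBelow (suc m) ind ≡ m
  firstBlock = begin
    sumBelow (1 + m) ind                        ≡⟨ sumBelow-split 1 m ind ⟩
    ind 0 + sumBelow m (λ j → ind (suc j))      ≡⟨ cong₂ _+_ zeroIsMultiple (sumBelow-cong m restIsNot) ⟩
    sumBelow m (λ _ → 1)                        ≡⟨ sumBelow-ones m ⟩
    m                                           ∎
    where
    zeroIsMultiple : ind 0 ≡ 0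
    zeroIsMultiple = 𝟙-no (λ ∤0 → ∤0 (suc m ∣0)) (nonMultiple? (suc m) 0)
    restIsNot : ∀ j → j < m → ind (suc j) ≡ 1
    restIsNot j j<m = 𝟙-yes (λ m∣1+j → <⇒≱ (s≤s j<m) (∣⇒≤ m∣1+j)) (nonMultiple? (suc m) (suc j))
    sumBelow-ones : ∀ n → sumBelow n (λ _ → 1) ≡ n
    sumBelow-ones zero    = refl
    sumBelow-ones (suc n) = trans (cong (_+ 1) (sumBelow-ones n)) (+-comm n 1)

subMod-≤ : ∀ v (a b : Fin v) → toℕ b ≤ toℕ a → subMod v a b ≡ toℕ a ∸ toℕ b
subMod-≤ v a b b≤a with toℕ b ≤? toℕ a
... | yes _   = refl
... | no  b≰a = contradiction b≤a b≰a

subMod-wrap : ∀ v (a b : Fin v) → toℕ a < toℕ b → subMod v a b ≡ v ∸ (toℕ b ∸ toℕ a)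
subMod-wrap v a b a<b with toℕ b ≤? toℕ a
... | yes b≤a = contradiction b≤a (<⇒≱ a<b)
... | no  _   = begin
  toℕ a + v ∸ toℕ b                       ≡⟨ cong (toℕ a + v ∸_) (sym (m+[n∸m]≡n (<⇒≤ a<b))) ⟩
  toℕ a + v ∸ (toℕ a + (toℕ b ∸ toℕ a))   ≡⟨ [m+n]∸[m+o]≡n∸o (toℕ a) v (toℕ b ∸ toℕ a) ⟩
  v ∸ (toℕ b ∸ toℕ a)                     ∎
  where open ≡-Reasoning

subMod-< : ∀ v (a b : Fin v) → subMod v a b < v
subMod-< v a b with toℕ a <? toℕ b
... | no  a≮b = subst (_< v) (sym (subMod-≤ v a b (≮⇒≥ a≮b))) (≤-<-trans (m∸n≤m (toℕ a) (toℕ b)) (toℕ<n a))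
... | yes a<b = subst (_< v) (sym (subMod-wrap v a b a<b))
                      (∸-monoʳ-< (m<n⇒0<n∸m a<b) (≤-trans (m∸n≤m (toℕ b) (toℕ a)) (<⇒≤ (toℕ<n b))))

absDiff-comm : ∀ a b → absDiff a b ≡ absDiff b a
absDiff-comm a b = +-comm (a ∸ b) (b ∸ a)

absDiff-≥ : ∀ {a b} → b ≤ a → absDiff a b ≡ a ∸ b
absDiff-≥ {a} {b} b≤a = trans (cong ((a ∸ b) +_) (m≤n⇒m∸n≡0 b≤a)) (+-identityʳ (a ∸ b))

absDiff-self : ∀ a → absDiff a a ≡ 0
absDiff-self a = cong₂ _+_ (n∸n≡0 a) (n∸n≡0 a)

-- Both orientations of a list of pairs; by definition D Γ = bothWays (edges Γ).
bothWays : {A : Set} → List (A × A) → List (A × A)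
bothWays = concatMap (λ xy → xy ∷ (proj₂ xy , proj₁ xy) ∷ [])

length-bothWays : {A : Set} (ps : List (A × A)) → length (bothWays ps) ≡ 2 * length ps
length-bothWays []       = refl
length-bothWays (p ∷ ps) = trans (cong (2 +_) (length-bothWays ps)) (sym (*-distribˡ-+ 2 1 (length ps)))

∈-bothWays : {A : Set} {x y : A} {ps : List (A × A)} → (x , y) ∈ ps →
             (x , y) ∈ bothWays ps × (y , x) ∈ bothWays ps
∈-bothWays (here refl) = here refl , there (here refl)
∈-bothWays (there xy∈ps) with ∈-bothWays xy∈ps
... | xy∈ , yx∈ = there (there xy∈) , there (there yx∈)

module SingleMap (v : ℕ) (Γ : Graph) (φ : V Γ → Fin v) where

  diff : V Γ × V Γ → ℕ
  diff xy = subMod v (φ (proj₁ xy)) (φ (proj₂ xy))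

  Δ : List ℕ
  Δ = diffList v Γ (φ ∷ [])

  Δ≡ : Δ ≡ map diff (D Γ)
  Δ≡ = ++-identityʳ (map diff (D Γ))

  length-Δ : length Δ ≡ 2 * size Γ
  length-Δ = trans (cong length Δ≡) (trans (length-map diff (D Γ)) (length-bothWays (edges Γ)))

  Δ-bounded : All (_< v) Δ
  Δ-bounded = subst (All (_< v)) (sym Δ≡) (All.map⁺ (universal (λ xy → subMod-< v (φ (proj₁ xy)) (φ (proj₂ xy))) (D Γ)))

  diff-∈ : ∀ {xy g} → diff xy ≡ g → xy ∈ D Γ → g ∈ Δ
  diff-∈ refl xy∈D = subst (_ ∈_) (sym Δ≡) (∈-map⁺ diff xy∈D)

  ordered-differences : ∀ {x y} → toℕ (φ y) < toℕ (φ x) → (x , y) ∈ D Γ → (y , x) ∈ D Γ →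
                        (toℕ (φ x) ∸ toℕ (φ y)) ∈ Δ × (v ∸ (toℕ (φ x) ∸ toℕ (φ y))) ∈ Δ
  ordered-differences {x} {y} y<x xy∈D yx∈D =
    diff-∈ (subMod-≤ v (φ x) (φ y) (<⇒≤ y<x)) xy∈D , diff-∈ (subMod-wrap v (φ y) (φ x) y<x) yx∈D

  edge-differences : ∀ {x y} → (x , y) ∈ edges Γ → 0 < absDiff (toℕ (φ x)) (toℕ (φ y)) →
                     absDiff (toℕ (φ x)) (toℕ (φ y)) ∈ Δ × (v ∸ absDiff (toℕ (φ x)) (toℕ (φ y))) ∈ Δ
  edge-differences {x} {y} xy∈E 0<k with <-cmp (toℕ (φ x)) (toℕ (φ y)) | ∈-bothWays xy∈E
  ... | tri> _ _ y<x | xy∈D , yx∈D =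
    subst (λ k → k ∈ Δ × (v ∸ k) ∈ Δ) (sym (absDiff-≥ (<⇒≤ y<x))) (ordered-differences y<x xy∈D yx∈D)
  ... | tri< x<y _ _ | xy∈D , yx∈D =
    subst (λ k → k ∈ Δ × (v ∸ k) ∈ Δ) (sym (trans (absDiff-comm (toℕ (φ x)) _) (absDiff-≥ (<⇒≤ x<y))))
          (ordered-differences x<y yx∈D xy∈D)
  ... | tri≈ _ x≡y _ | _ =
    contradiction 0<k (<-irrefl (sym (trans (cong (absDiff (toℕ (φ x))) (sym x≡y)) (absDiff-self (toℕ (φ x))))))

module Covering (Γ : Graph) (d m : ℕ) (f : V Γ → ℕ) (graceful : IsGraceful d m Γ f)
                (φ : V Γ → Fin (2 * d * suc m)) (φ≗f : ∀ x → toℕ (φ x) ≡ f x) where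

  p N v : ℕ
  p = suc m
  N = d * p
  v = 2 * d * p

  open SingleMap v Γ φ using (Δ; edge-differences)

  v≡N+N : v ≡ N + N
  v≡N+N = trans (*-assoc 2 d p) (cong (N +_) (+-identityʳ N))

  distance-realised : ∀ k → 1 ≤ k → k < N → ¬ (p ∣ k) → k ∈ Δ × (v ∸ k) ∈ Δ
  distance-realised k 1≤k k<N p∤k with Equivalence.from (IsGraceful.edgeSet graceful k) (1≤k , k<N , p∤k)
  ... | (x , y) , xy∈E , dist≡k =
    subst (λ k → k ∈ Δ × (v ∸ k) ∈ Δ) φ-dist≡k (edge-differences xy∈E (subst (1 ≤_) (sym φ-dist≡k) 1≤k))
    where
    φ-dist≡k : absDiff (toℕ (φ x)) (toℕ (φ y)) ≡ k
    φ-dist≡k = trans (cong₂ absDiff (φ≗f x) (φ≗f y)) dist≡k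

  -- Non-multiples in [N, v) are reflected by g ↦ v - g onto non-multiples in [1, N).
  covers : ∀ g → g < v → ¬ (p ∣ g) → g ∈ Δ
  covers zero    _   p∤g = contradiction (p ∣0) p∤g
  covers g@(suc _) g<v p∤g with g <? N
  ... | yes g<N = proj₁ (distance-realised g (s≤s z≤n) g<N p∤g)
  ... | no  g≮N = subst (_∈ Δ) (m∸[m∸n]≡n (<⇒≤ g<v)) (proj₂ (distance-realised k (m<n⇒0<n∸m g<v) k<N p∤k))
    where
    k : ℕ
    k = v ∸ g
    k+g≡v : k + g ≡ v
    k+g≡v = m∸n+n≡m (<⇒≤ g<v)
    p∤k : ¬ (p ∣ k)
    p∤k p∣k = p∤g (∣m+n∣m⇒∣n (subst (p ∣_) (sym k+g≡v) (divides (2 * d) refl)) p∣k)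
    k≤N : k ≤ N
    k≤N = +-cancelʳ-≤ N k N (subst (k + N ≤_) (trans k+g≡v v≡N+N) (+-monoʳ-≤ k (≮⇒≥ g≮N)))
    k≢N : k ≢ N
    k≢N k≡N = p∤g (subst (p ∣_) (sym g≡N) (divides d refl))
      where
      g≡N : g ≡ N
      g≡N = +-cancelˡ-≡ N g N (trans (cong (_+ g) (sym k≡N)) (trans k+g≡v v≡N+N))
    k<N : k < N
    k<N = ≤∧≢⇒< k≤N k≢N

proposition2p3 : (Γ : Graph) (d m : ℕ) → 1 ≤ d → size Γ ≡ d * m →
    (f : V Γ → ℕ) → IsGraceful d m Γ f →
    (φ : V Γ → Fin (2 * d * suc m)) → (∀ x → toℕ (φ x) ≡ f x) →
    IsDifferenceFamily (2 * d * suc m) (2 * d) (divides (suc m) (*-comm (2 * d) (suc m))) Γ (φ ∷ [])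
proposition2p3 Γ d m _ size≡dm f graceful φ φ≗f = record
  { injectiveMaps = φ-injective ∷ []
  ; outside       = λ g g<v p∤g → trans (exact g g<v) (𝟙-yes p∤g (nonMultiple? (suc m) g))
  ; inside        = λ g g<v p∣g → trans (exact g g<v) (𝟙-no (λ p∤g → p∤g p∣g) (nonMultiple? (suc m) g))
  }
  where
  open SingleMap (2 * d * suc m) Γ φ using (Δ; Δ-bounded; length-Δ)
  open Covering Γ d m f graceful φ φ≗f using (covers)

  length-Δ≡count : length Δ ≡ sumBelow (2 * d * suc m) (λ g → 𝟙 (nonMultiple? (suc m) g))
  length-Δ≡count = trans length-Δ (trans (cong (2 *_) size≡dm)
                     (trans (sym (*-assoc 2 d m)) (sym (nonMultiples m (2 * d)))))

  exact : ∀ g → g < 2 * d * suc m → occ g Δ ≡ 𝟙 (nonMultiple? (suc m) g)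
  exact = occ-exact (nonMultiple? (suc m)) (2 * d * suc m) Δ Δ-bounded covers length-Δ≡count

  φ-injective : Injective _≡_ _≡_ φ
  φ-injective {x} {y} φx≡φy = IsGraceful.injective graceful (trans (sym (φ≗f x)) (trans (cong toℕ φx≡φy) (φ≗f y)))
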